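{- Let $G$ be a $\lambda$-graph and $Q$ a query over $G$. If there exists a sharing equivalence containing $Q$, then the spreading $Q^{\#}$ is the smallest sharing equivalence containing $Q$.
   Context: A pre-$\lambda$-graph is a directed graph with four kinds of nodes: application nodes $\mathrm{App}(n_1,n_2)$ (left child $n_1$, direction $\swarrow$; right child $n_2$, direction $\searrow$); abstraction nodes $\mathrm{Abs}(n)$ (child $n$, direction $\downarrow$); free variable nodes (no children, each carrying an atom, distinct nodes carrying distinct atoms); bound variable nodes $\mathrm{Var}(l)$ with a binding edge to an abstraction node $l$. Paths $n\xrightarrow{\tau}m$ follow only the child edges, never binding edges, and are recorded by their trace $\tau$ (a finite sequence of directions). A root is a node with no path of nonempty trace ending at it. A path crosses $m$ if it visits $m$; $m$ dominates $n$ if every path from a root to $n$ crosses $m$. A $\lambda$-graph is a finite pre-$\lambda$-graph, acyclic (no path of nonempty trace from a node to itself), in which each bound variable node is dominated by its binder. Nodes are homogeneous if of the same kind; a relation is homogeneous if it only relates homogeneous nodes. A sharing equivalence is an equivalence relation $R$ on nodes which is homogeneous, closed under $\mathrm{App}(n_1,n_2)\,R\,\mathrm{App}(m_1,m_2)\Rightarrow n_1Rm_1$ and $\Rightarrow n_2Rm_2$, $\mathrm{Abs}(n)\,R\,\mathrm{Abs}(m)\Rightarrow nRm$, $\mathrm{Var}(n)\,R\,\mathrm{Var}(m)\Rightarrow nRm$ (bound variable nodes with binders $n,m$), and open: free variable nodes $v R w$ implies $v=w$. A query over $G$ is a binary relation on the roots of $G$. The spreading $Q^{\#}$ is the smallest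 relation containing $Q$ closed under reflexivity, symmetry, transitivity and the three rules for $\mathrm{App}$ and $\mathrm{Abs}$ (not the $\mathrm{Var}$ rule). -}

module Defs where

open import Level using (0ℓ)
open import Data.Nat using (ℕ)
open import Data.Fin using (Fin)
open import Data.Product using (Σ; ∃; _×_; _,_)
open import Relation.Binary.PropositionalEquality using (_≡_)
open import Relation.Binary.Core using (Rel; _⇒_)
open import Relation.Binary.Structures using (IsEquivalence)
open import Relation.Nullary using (¬_)

Atom : Set
Atom = ℕ

data NodeKind (n : ℕ) : Set where
  app : Fin n → Fin n → NodeKind n
  abs : Fin n → NodeKind n
  fv  : Atom → NodeKind n
  bv  : Fin n → NodeKind n           -- Var(l), binding edge to l

data Kind : Set where
  kApp kAbs kFv kBv : Kind

kind : ∀ {n} → NodeKind n → Kind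
kind (app _ _) = kApp
kind (abs _)   = kAbs
kind (fv _)    = kFv
kind (bv _)    = kBv

record PreGraph (n : ℕ) : Set where
  field
    node     : Fin n → NodeKind n
    fv-inj   : ∀ {a b x} → node a ≡ fv x → node b ≡ fv x → a ≡ b
    binder-abs : ∀ {a l} → node a ≡ bv l → ∃ λ c → node l ≡ abs c

module _ {n : ℕ} (G : PreGraph n) where
  open PreGraph G

  data Dir : Set where
    ↙ ↘ ↓ : Dir

  -- child edges (binding edges are not edges here)
  data Edge : Fin n → Dir → Fin n → Set where
    eL : ∀ {a b c} → node a ≡ app b c → Edge a ↙ b
    eR : ∀ {a b c} → node a ≡ app b c → Edge a ↘ c
    eD : ∀ {a b}   → node a ≡ abs b   → Edge a ↓ b

  -- paths, with their trace implicit in the sequence of edges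
  data Path : Fin n → Fin n → Set where
    [] : ∀ {a} → Path a a
    _∷_ : ∀ {a d b c} → Edge a d b → Path b c → Path a c

  nonEmpty : ∀ {a b} → Path a b → Set
  nonEmpty []      = Data.Empty.⊥ where import Data.Empty
  nonEmpty (_ ∷ _) = Data.Unit.⊤ where import Data.Unit

  IsRoot : Fin n → Set
  IsRoot r = ∀ m → (p : Path m r) → ¬ nonEmpty p

  data Crosses (m : Fin n) : ∀ {a b} → Path a b → Set where
    here  : ∀ {b} (p : Path m b) → Crosses m p
    there : ∀ {a d b c} (e : Edge a d b) {p : Path b c} → Crosses m p → Crosses m (e ∷ p)

  Dominates : Fin n → Fin n → Set
  Dominates m a = ∀ r → IsRoot r → (p : Path r a) → Crosses m p

  Acyclic : Set
  Acyclic = ∀ a → (p : Path a a) → ¬ nonEmpty p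

  record IsLambdaGraph : Set where
    field
      acyclic   : Acyclic
      dominated : ∀ {a l} → node a ≡ bv l → Dominates l a

  Homogeneous : Rel (Fin n) 0ℓ → Set
  Homogeneous R = ∀ {a b} → R a b → kind (node a) ≡ kind (node b)

  record IsSharingEquivalence (R : Rel (Fin n) 0ℓ) : Set where
    field
      isEquivalence : IsEquivalence R
      homogeneous   : Homogeneous R
      app-closedˡ : ∀ {a b a₁ a₂ b₁ b₂} → node a ≡ app a₁ a₂ → node b ≡ app b₁ b₂ → R a b → R a₁ b₁
      app-closedʳ : ∀ {a b a₁ a₂ b₁ b₂} → node a ≡ app a₁ a₂ → node b ≡ app b₁ b₂ → R a b → R a₂ b₂
      abs-closed  : ∀ {a b a₁ b₁} → node a ≡ abs a₁ → node b ≡ abs b₁ → R a b → R a₁ b₁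
      var-closed  : ∀ {a b l k} → node a ≡ bv l → node b ≡ bv k → R a b → R l k
      open-fv     : ∀ {a b x y} → node a ≡ fv x → node b ≡ fv y → R a b → a ≡ b

  IsQuery : Rel (Fin n) 0ℓ → Set
  IsQuery Q = ∀ {a b} → Q a b → IsRoot a × IsRoot b

  data Spread (Q : Rel (Fin n) 0ℓ) : Rel (Fin n) 0ℓ where
    base  : ∀ {a b} → Q a b → Spread Q a b
    refl′ : ∀ {a} → Spread Q a a
    sym′  : ∀ {a b} → Spread Q a b → Spread Q b a
    trans′ : ∀ {a b c} → Spread Q a b → Spread Q b c → Spread Q a c
    appˡ  : ∀ {a b a₁ a₂ b₁ b₂} → node a ≡ app a₁ a₂ → node b ≡ app b₁ b₂ → Spread Q a b → Spread Q a₁ b₁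
    appʳ  : ∀ {a b a₁ a₂ b₁ b₂} → node a ≡ app a₁ a₂ → node b ≡ app b₁ b₂ → Spread Q a b → Spread Q a₂ b₂
    absˢ  : ∀ {a b a₁ b₁} → node a ≡ abs a₁ → node b ≡ abs b₁ → Spread Q a b → Spread Q a₁ b₁

  IsSmallestSharingEquivContaining : Rel (Fin n) 0ℓ → Rel (Fin n) 0ℓ → Set₁
  IsSmallestSharingEquivContaining Q R =
    IsSharingEquivalence R × (Q ⇒ R) ×
    (∀ (S : Rel (Fin n) 0ℓ) → IsSharingEquivalence S → Q ⇒ S → R ⇒ S)

module Submission where

-- Every sharing equivalence containing Q is closed under the rules generating
-- Q#, so it contains Q# (minimality); in particular Q# ⊆ R, which gives
-- homogeneity and openness, and the App/Abs rules hold by construction.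
-- The real work is the Var rule, proved for the ends of parallel walks (equal
-- traces) by induction on the derivation of Q#; transitivity is handled by
-- transporting walks along R, and everything reduces to Q-related roots.
-- There the binders dominate the variables, so both walks pass through them
-- and one trace prefix extends the other by some δ.  If δ ≠ [], a node would
-- reach an R-related node by a nonempty walk; iterating the transport of that
-- walk along R yields more than n nodes in a descending chain, hence a cycle.

open import Defs
open import Level using (0ℓ)
open import Data.Nat using (ℕ)
open import Data.Fin using (Fin)
open import Data.Product using (Σ; ∃; _×_)
open import Relation.Binary.Core using (Rel; _⇒_)

open import Data.Nat using (zero; suc; s≤s; _<_)
open import Data.Nat.Properties using (n<1+n; m≤n⇒m<n∨m≡n)
open import Data.Fin using (toℕ)
open import Data.Fin.Properties using (pigeonhole)
open import Data.Product using (∃₂; _,_; proj₁; proj₂; map₂)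
open import Data.Sum using (_⊎_; inj₁; inj₂)
import Data.Sum as Sum
open import Data.List using (List; []; _∷_; _++_)
open import Data.List.Properties using (∷-injective)
open import Data.Empty using (⊥; ⊥-elim)
open import Data.Unit using (tt)
open import Relation.Binary.PropositionalEquality using (_≡_; refl; sym; trans; cong; subst)
open import Relation.Binary.Structures using (IsEquivalence)

prefix-or-prefix : ∀ {A : Set} (τ₁ τ₂ σ₁ σ₂ : List A) → τ₁ ++ τ₂ ≡ σ₁ ++ σ₂ →
  (∃ λ δ → σ₁ ≡ τ₁ ++ δ) ⊎ (∃ λ δ → τ₁ ≡ σ₁ ++ δ)
prefix-or-prefix []       _  σ₁       _  _  = inj₁ (σ₁ , refl)
prefix-or-prefix (x ∷ τ₁) _  []       _  _  = inj₂ (x ∷ τ₁ , refl)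
prefix-or-prefix (x ∷ τ₁) τ₂ (y ∷ σ₁) σ₂ eq with ∷-injective eq
... | refl , eq′ = Sum.map (map₂ (cong (x ∷_))) (map₂ (cong (x ∷_)))
                           (prefix-or-prefix τ₁ τ₂ σ₁ σ₂ eq′)

module Walks {n : ℕ} (G : PreGraph n) where
  data Walk : Fin n → List (Dir G) → Fin n → Set where
    []  : ∀ {a} → Walk a [] a
    _∷_ : ∀ {a d b τ c} → Edge G a d b → Walk b τ c → Walk a (d ∷ τ) c

  toPath : ∀ {a τ b} → Walk a τ b → Path G a b
  toPath []      = []
  toPath (e ∷ w) = e ∷ toPath w

  split : ∀ {a} τ {σ c} → Walk a (τ ++ σ) c → ∃ λ b → Walk a τ b × Walk b σ c
  split []      w       = _ , [] , w
  split (_ ∷ τ) (e ∷ w) with split τ w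
  ... | b , w₁ , w₂ = b , e ∷ w₁ , w₂

  split-at-crossing : ∀ {m a τ b} (w : Walk a τ b) → Crosses G m (toPath w) →
    ∃₂ λ τ₁ τ₂ → τ₁ ++ τ₂ ≡ τ × Walk a τ₁ m × Walk m τ₂ b
  split-at-crossing []      (here _)    = [] , [] , refl , [] , []
  split-at-crossing (e ∷ w) (here _)    = [] , _ , refl , [] , e ∷ w
  split-at-crossing (e ∷ w) (there _ c) with split-at-crossing w c
  ... | τ₁ , τ₂ , eq , w₁ , w₂ = _ ∷ τ₁ , τ₂ , cong (_ ∷_) eq , e ∷ w₁ , w₂

  edge-functional : ∀ {a d b b′} → Edge G a d b → Edge G a d b′ → b ≡ b′
  edge-functional (eL p) (eL q) with trans (sym p) q
  ... | refl = refl
  edge-functional (eR p) (eR q) with trans (sym p) q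
  ... | refl = refl
  edge-functional (eD p) (eD q) with trans (sym p) q
  ... | refl = refl

  walk-functional : ∀ {a τ b b′} → Walk a τ b → Walk a τ b′ → b ≡ b′
  walk-functional []      []        = refl
  walk-functional (e ∷ w) (e′ ∷ w′) with edge-functional e e′
  ... | refl = walk-functional w w′

app-of-kind : ∀ {n} (k : NodeKind n) → kind k ≡ kApp → ∃₂ λ b c → k ≡ app b c
app-of-kind (app b c) refl = b , c , refl

abs-of-kind : ∀ {n} (k : NodeKind n) → kind k ≡ kAbs → ∃ λ b → k ≡ abs b
abs-of-kind (abs b) refl = b , refl

bv-of-kind : ∀ {n} (k : NodeKind n) → kind k ≡ kBv → ∃ λ l → k ≡ bv l
bv-of-kind (bv l) refl = l , refl

module Transport {n : ℕ} {G : PreGraph n} {R : Rel (Fin n) 0ℓ}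
                 (RS : IsSharingEquivalence G R) where
  open PreGraph G
  open Walks G
  open IsSharingEquivalence RS

  partner-kind : ∀ {x z k} → R x z → node x ≡ k → kind (node z) ≡ kind k
  partner-kind r p = trans (sym (homogeneous r)) (cong kind p)

  bound-partner : ∀ {x z l} → R x z → node x ≡ bv l → ∃ λ m → node z ≡ bv m
  bound-partner {z = z} r p = bv-of-kind (node z) (partner-kind r p)

  edge-transport : ∀ {x z d x′} → R x z → Edge G x d x′ →
    ∃ λ z′ → Edge G z d z′ × R x′ z′
  edge-transport {z = z} r (eL p) with app-of-kind (node z) (partner-kind r p)
  ... | z₁ , _ , q = z₁ , eL q , app-closedˡ p q r
  edge-transport {z = z} r (eR p) with app-of-kind (node z) (partner-kind r p)
  ... | _ , z₂ , q = z₂ , eR q , app-closedʳ p q r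
  edge-transport {z = z} r (eD p) with abs-of-kind (node z) (partner-kind r p)
  ... | z₁ , q = z₁ , eD q , abs-closed p q r

  walk-transport : ∀ {x z τ a} → R x z → Walk x τ a → ∃ λ c → Walk z τ c × R a c
  walk-transport r []      = _ , [] , r
  walk-transport r (e ∷ w) with edge-transport r e
  ... | _ , e′ , r′ with walk-transport r′ w
  ... | c , w′ , r″ = c , e′ ∷ w′ , r″

  parallel-related : ∀ {x y τ a b} → R x y → Walk x τ a → Walk y τ b → R a b
  parallel-related r wa wb with walk-transport r wa
  ... | c , wc , rac with walk-functional wb wc
  ... | refl = rac

module NoDescent {n : ℕ} {G : PreGraph n} (acyclic : Acyclic G)
                 {R : Rel (Fin n) 0ℓ} (RS : IsSharingEquivalence G R) where
  open Walks G
  open Transport RS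

  Descent : Fin n → Fin n → Set
  Descent a c = ∃₂ λ d b → Edge G a d b × Path G b c

  _++ᵖ_ : ∀ {a b c} → Path G a b → Path G b c → Path G a c
  []      ++ᵖ q = q
  (e ∷ p) ++ᵖ q = e ∷ (p ++ᵖ q)

  walk-descent : ∀ {a d δ c} → Walk a (d ∷ δ) c → Descent a c
  walk-descent (e ∷ w) = _ , _ , e , toPath w

  extend : ∀ {a b c} → Descent a b → Path G b c → Descent a c
  extend (d , b , e , p) q = d , b , e , p ++ᵖ q

  record Link (δ : List (Dir G)) : Set where
    constructor link
    field
      source target : Fin n
      related       : R source target
      walk          : Walk source δ target
  open Link

  next : ∀ {δ} → Link δ → Link δ
  next (link _ y r w) = let (c , w′ , r′) = walk-transport r w in link y c r′ w′

  chain : ∀ {δ} → Link δ → ℕ → Link δ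
  chain start zero    = start
  chain start (suc i) = next (chain start i)

  point : ∀ {δ} → Link δ → ℕ → Fin n
  point start i = source (chain start i)

  chain-descent : ∀ {d δ} (start : Link (d ∷ δ)) {i j} → i < j →
    Descent (point start i) (point start j)
  chain-descent start {i} {suc j} (s≤s i≤j) with m≤n⇒m<n∨m≡n i≤j
  ... | inj₁ i<j  = extend (chain-descent start i<j) (toPath (walk (chain start j)))
  ... | inj₂ refl = walk-descent (walk (chain start i))

  -- Among the first n + 1 points of a chain two coincide, closing a cycle.
  chain-cycle : ∀ {d δ} → Link (d ∷ δ) → ⊥
  chain-cycle start with pigeonhole (n<1+n n) (λ i → point start (toℕ i))
  ... | i , j , i<j , same with chain-descent start i<j
  ... | _ , b , e , p = acyclic _ (e ∷ subst (Path G b) (sym same) p) tt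

  related-no-descent : ∀ {u v d δ} → R u v → Walk u (d ∷ δ) v → ⊥
  related-no-descent r w = chain-cycle (link _ _ r w)

module Spreading {n : ℕ} (G : PreGraph n) (Q : Rel (Fin n) 0ℓ) where
  open Walks G

  spread-least : ∀ {S : Rel (Fin n) 0ℓ} → IsSharingEquivalence G S → Q ⇒ S →
    Spread G Q ⇒ S
  spread-least {S} SS QS = go
    where
      open IsSharingEquivalence SS
      module S = IsEquivalence isEquivalence
      go : Spread G Q ⇒ S
      go (base q)       = QS q
      go refl′          = S.refl
      go (sym′ s)       = S.sym (go s)
      go (trans′ s t)   = S.trans (go s) (go t)
      go (appˡ p q s)   = app-closedˡ p q (go s)
      go (appʳ p q s)   = app-closedʳ p q (go s)
      go (absˢ p q s)   = abs-closed p q (go s)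

  spread-walk : ∀ {x y τ a b} → Spread G Q x y → Walk x τ a → Walk y τ b →
    Spread G Q a b
  spread-walk s []          []          = s
  spread-walk s (eL p ∷ wa) (eL q ∷ wb) = spread-walk (appˡ p q s) wa wb
  spread-walk s (eR p ∷ wa) (eR q ∷ wb) = spread-walk (appʳ p q s) wa wb
  spread-walk s (eD p ∷ wa) (eD q ∷ wb) = spread-walk (absˢ p q s) wa wb

-- Closure of the spreading under the Var rule, given a sharing equivalence
-- R ⊇ Q on a λ-graph.
module Binders {n : ℕ} {G : PreGraph n} (LG : IsLambdaGraph G)
               {Q : Rel (Fin n) 0ℓ} (isQ : IsQuery G Q)
               {R : Rel (Fin n) 0ℓ} (RS : IsSharingEquivalence G R) (QR : Q ⇒ R) where
  open PreGraph G
  open IsLambdaGraph LG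
  open IsSharingEquivalence RS using (isEquivalence; var-closed)
  module R = IsEquivalence isEquivalence
  open Walks G
  open Transport RS
  open NoDescent acyclic RS
  open Spreading G Q

  Sp : Rel (Fin n) 0ℓ
  Sp = Spread G Q

  spread⊆R : Sp ⇒ R
  spread⊆R = spread-least RS QR

  -- If x Q# y, x reaches l along τ, y reaches k along τ ++ δ and l R k, then
  -- δ is empty and l Q# k: a nonempty δ would make k descend from a node
  -- related to it.
  aligned-binders : ∀ {x y l k} τ {δ} → Sp x y → Walk x τ l → Walk y (τ ++ δ) k →
    R l k → Sp l k
  aligned-binders {l = l} {k} τ s wl wk rlk with split τ wk
  ... | _ , wm , rest = finish (spread-walk s wl wm) rest
    where
      finish : ∀ {m δ} → Sp l m → Walk m δ k → Sp l k
      finish slm []       = slm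
      finish slm (e ∷ w) =
        ⊥-elim (related-no-descent (R.trans (R.sym (spread⊆R slm)) rlk) (e ∷ w))

  -- Parallel walks from Q-related roots to bound variables: the binders
  -- dominate the variables, so both walks cross them, and the binder met
  -- first lies on a common prefix of the traces.
  query-binders : ∀ {x y τ a b l k} → Q x y → Walk x τ a → Walk y τ b →
    node a ≡ bv l → node b ≡ bv k → Sp l k
  query-binders q wa wb pa pb
    with split-at-crossing wa (dominated pa _ (proj₁ (isQ q)) (toPath wa))
       | split-at-crossing wb (dominated pb _ (proj₂ (isQ q)) (toPath wb))
       | var-closed pa pb (parallel-related (QR q) wa wb)
  ... | τ₁ , τ₂ , eqa , wxl , _ | σ₁ , σ₂ , eqb , wyk , _ | rlk
    with prefix-or-prefix τ₁ τ₂ σ₁ σ₂ (trans eqa (sym eqb))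
  ... | inj₁ (_ , refl) = aligned-binders τ₁ (base q) wxl wyk rlk
  ... | inj₂ (_ , refl) = sym′ (aligned-binders σ₁ (sym′ (base q)) wyk wxl (R.sym rlk))

  -- The Var rule for the spreading, generalised to parallel walks so that
  -- induction on the derivation goes through.
  spread-binders : ∀ {x y τ a b l k} → Sp x y → Walk x τ a → Walk y τ b →
    node a ≡ bv l → node b ≡ bv k → Sp l k
  spread-binders (base q) wa wb pa pb = query-binders q wa wb pa pb
  spread-binders refl′ wa wb pa pb with walk-functional wa wb
  ... | refl with trans (sym pa) pb
  ... | refl = refl′
  spread-binders (sym′ s) wa wb pa pb = sym′ (spread-binders s wb wa pb pa)
  spread-binders (trans′ s t) wa wb pa pb with walk-transport (spread⊆R s) wa
  ... | _ , wc , rac with bound-partner rac pa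
  ... | _ , pc = trans′ (spread-binders s wa wc pa pc) (spread-binders t wc wb pc pb)
  spread-binders (appˡ p q s) wa wb = spread-binders s (eL p ∷ wa) (eL q ∷ wb)
  spread-binders (appʳ p q s) wa wb = spread-binders s (eR p ∷ wa) (eR q ∷ wb)
  spread-binders (absˢ p q s) wa wb = spread-binders s (eD p ∷ wa) (eD q ∷ wb)

  spread-sharing : IsSharingEquivalence G Sp
  spread-sharing = record
    { isEquivalence = record { refl = refl′ ; sym = sym′ ; trans = trans′ }
    ; homogeneous   = λ s → IsSharingEquivalence.homogeneous RS (spread⊆R s)
    ; app-closedˡ   = appˡ
    ; app-closedʳ   = appʳ
    ; abs-closed    = absˢ
    ; var-closed    = λ pa pb s → spread-binders s [] [] pa pb
    ; open-fv       = λ pa pb s → IsSharingEquivalence.open-fv RS pa pb (spread⊆R s)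
    }

mainTheorem4 : ∀ {n : ℕ} (G : PreGraph n) → IsLambdaGraph G →
    (Q : Rel (Fin n) 0ℓ) → IsQuery G Q →
    (∃ λ (R : Rel (Fin n) 0ℓ) → IsSharingEquivalence G R × (Q ⇒ R)) →
    IsSmallestSharingEquivContaining G Q (Spread G Q)
mainTheorem4 G LG Q isQ (R , RS , QR) =
  spread-sharing , base , λ S SS QS → spread-least SS QS
  where
    open Binders LG isQ RS QR using (spread-sharing)
    open Spreading G Q using (spread-least)
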